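{- Let $\mathcal{C}$ be a hypergraph on $V$ and $F$ an edge of $\mathcal{C}$. (i) If $\operatorname{conn_h}(\operatorname{Ind}(\mathcal{C}-F))>\operatorname{conn_h}(\operatorname{Ind}(\mathcal{C}))$, then $\operatorname{conn_h}(\operatorname{Ind}(\mathcal{C}:F))\ge\operatorname{conn_h}(\operatorname{Ind}(\mathcal{C}))-|F|+1$. (ii) If $\operatorname{conn_h}(\operatorname{Ind}(\mathcal{C}:F))\ge \operatorname{conn_h}(\operatorname{Ind}(\mathcal{C}))-|F|+1$, then $\operatorname{conn_h}(\operatorname{Ind}(\mathcal{C}-F))\ge\operatorname{conn_h}(\operatorname{Ind}(\mathcal{C}))$.
   Context: A hypergraph $\mathcal{C}$ on a finite vertex set $V$ is a family of pairwise incomparable subsets of $V$ (edges), each of cardinality at least $2$. $\operatorname{Ind}(\mathcal{C})$ is the simplicial complex on $V$ of subsets containing no edge. For an edge $F$: $\mathcal{C}-F$ has vertex set $V$ and edge set $\mathcal{C}\setminus\{F\}$; $N_{\mathcal{C}}(F)=\bigcup\{E\setminus F: E\in\mathcal{C},|E\setminus F|=1\}$; $\mathcal{C}:F$ is the hypergraph on $V\setminus(F\cup N_{\mathcal{C}}(F))$ whose edges are the inclusion-minimal sets among $\{E\setminus F:E\in\mathcal{C}-F\}$ of size at least $2$ (those meeting $N_{\mathcal{C}}(F)$ discarded). $\operatorname{conn_h}(\Delta)$ is the largest integer $k$ with $\tilde H_i(\Delta;\mathbb{Z})=0$ for all $-1\le i\le k$ ($\infty$ if all vanish). -}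

module Defs where

open import Data.Nat as ℕ using (ℕ; zero; suc; _<ᵇ_)
open import Data.Integer as ℤ using (ℤ; +_; _+_; _*_; -_; _-_)
open import Data.Fin using (Fin; toℕ)
open import Data.Fin.Subset using (Subset; _∈_; _∉_; _⊆_; _∪_; _∩_; _─_; ∁; ∣_∣; ⁅_⁆; Empty)
open import Data.Vec using (lookup)
open import Data.Bool using (Bool; true; false; _∧_; if_then_else_)
open import Data.Product using (Σ; _×_; ∃)
open import Relation.Binary.PropositionalEquality using (_≡_; _≢_)
open import Relation.Nullary using (¬_)
open import Data.Unit using (⊤)
open import Data.Empty using (⊥)

record Hypergraph (n : ℕ) : Set₁ where
  field
    Edge         : Subset n → Set
    edge-size    : ∀ E → Edge E → 2 ℕ.≤ ∣ E ∣
    incomparable : ∀ E E′ → Edge E → Edge E′ → E ⊆ E′ → E ≡ E′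
open Hypergraph public

-- Edge set of  C - F  (vertex set stays V).
minusEdges : ∀ {n} → Hypergraph n → Subset n → Subset n → Set
minusEdges C F E = Edge C E × E ≢ F

-- N_C(F) = ⋃ {E ∖ F : E ∈ C, |E ∖ F| = 1}, given by membership.
inN : ∀ {n} → Hypergraph n → Subset n → Fin n → Set
inN C F x = Σ (Subset _) λ E → Edge C E × ∣ E ─ F ∣ ≡ 1 × x ∈ E ─ F

-- Vertex set of C : F, namely V ∖ (F ∪ N_C(F)).
colonVerts : ∀ {n} → Hypergraph n → Subset n → Fin n → Set
colonVerts C F x = x ∉ F × ¬ inN C F x

colonCand : ∀ {n} → Hypergraph n → Subset n → Subset n → Set
colonCand C F G =
  Σ (Subset _) λ E → minusEdges C F E × G ≡ E ─ F × 2 ℕ.≤ ∣ G ∣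
    × (∀ x → x ∈ G → ¬ inN C F x)

colonEdges : ∀ {n} → Hypergraph n → Subset n → Subset n → Set
colonEdges C F G = colonCand C F G × (∀ G′ → colonCand C F G′ → G′ ⊆ G → G′ ≡ G)

-- Independence complex on a vertex set W ⊆ V of a family of edges,
-- given by its face predicate on subsets of V.

Ind : ∀ {n} → (Fin n → Set) → (Subset n → Set) → Subset n → Set
Ind W Ed σ = (∀ x → x ∈ σ → W x) × (∀ E → Ed E → ¬ (E ⊆ σ))

allV : ∀ {n} → Fin n → Set
allV _ = ⊤

-- A simplex is a subset σ; the empty face ∅ sits in dimension -1.
-- A chain in dimension k - 1 (i.e. supported on faces of cardinality k)
-- is a function  Subset n → ℤ  vanishing off such faces.

sumFin : ∀ {n} → (Fin n → ℤ) → ℤ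
sumFin {zero}  f = + 0
sumFin {suc n} f = f Data.Fin.zero + sumFin (λ i → f (Data.Fin.suc i))

sgn : ℕ → ℤ
sgn zero          = + 1
sgn (suc zero)    = - (+ 1)
sgn (suc (suc m)) = sgn m

below : ∀ {n} → Subset n → Fin n → ℕ
below τ v = ℤ.∣ sumFin (λ u → if lookup τ u ∧ (toℕ u <ᵇ toℕ v) then + 1 else + 0) ∣

-- boundary:  (∂ c)(τ) = Σ_{v ∉ τ} (-1)^{#{u ∈ τ : u < v}} c(τ ∪ {v}),
-- i.e. ∂[v₀,…,v_k] = Σ_j (-1)^j [v₀,…,v̂_j,…,v_k] (augmented: ∂[v] = [∅]).
∂ : ∀ {n} → (Subset n → ℤ) → Subset n → ℤ
∂ c τ = sumFin (λ v → if lookup τ v then + 0 else sgn (below τ v) * c (τ ∪ ⁅ v ⁆))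

IsChain : ∀ {n} → (Subset n → Set) → ℕ → (Subset n → ℤ) → Set
IsChain Δ k c = ∀ σ → ¬ (Δ σ × ∣ σ ∣ ≡ k) → c σ ≡ + 0

-- H̃_{k-1}(Δ; ℤ) = 0 : every (k-1)-cycle is a boundary.
HVanish : ∀ {n} → (Subset n → Set) → ℕ → Set
HVanish Δ k = ∀ c → IsChain Δ k c → (∀ τ → ∂ c τ ≡ + 0) →
  Σ (Subset _ → ℤ) λ d → IsChain Δ (suc k) d × (∀ σ → ∂ d σ ≡ c σ)

-- H̃_i(Δ) = 0 for all -1 ≤ i ≤ m   (i = k - 1)
Acyclic : ∀ {n} → (Subset n → Set) → ℤ → Set
Acyclic Δ m = ∀ k → + k ℤ.≤ m + + 1 → HVanish Δ k

data ℤ∞ : Set where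
  fin : ℤ → ℤ∞
  ∞   : ℤ∞

data _≤∞_ : ℤ∞ → ℤ∞ → Set where
  fin≤fin : ∀ {a b} → a ℤ.≤ b → fin a ≤∞ fin b
  _≤∞∞    : ∀ a → a ≤∞ ∞

_<∞_ : ℤ∞ → ℤ∞ → Set
fin a <∞ fin b = a ℤ.< b
fin a <∞ ∞     = ⊤
∞     <∞ _     = ⊥

_⊖_⊕1 : ℤ∞ → ℕ → ℤ∞
fin a ⊖ k ⊕1 = fin (a - + k + + 1)
∞     ⊖ k ⊕1 = ∞

ConnH : ∀ {n} → (Subset n → Set) → ℤ∞ → Set
ConnH Δ (fin m) = Acyclic Δ m × ¬ Acyclic Δ (m + + 1)
ConnH Δ ∞       = ∀ m → Acyclic Δ m

-- Ind(C) ⊆ Ind(C − F), and a face of Ind(C − F) lies outside Ind(C) exactly when it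
-- contains F; such faces are τ ∪ F with τ a face of Ind(C : F).  So the relative chain
-- complex of the pair (Ind(C − F), Ind(C)) is the chain complex of Ind(C : F) shifted
-- up by |F| (the isomorphism τ ↦ τ ∪ F twisted by a sign), and the long exact sequence
-- of the pair gives, in each degree, the two implications between the vanishing of
-- homology of the three complexes.

module Submission where

open import Defs
import Algebra.Properties.CommutativeSemigroup as CommSemigroupProperties
open import Data.Fin.Subset using (Subset; ∣_∣)

open import Data.Nat as ℕ using (ℕ; zero; suc; _<ᵇ_)
import Data.Nat.Properties as ℕP
open import Data.Integer as ℤ using (ℤ; +_; -[1+_]; _+_; _*_; -_; _-_)
import Data.Integer.Properties as ℤP
open import Data.Integer.Tactic.RingSolver using (solve-∀)
open import Data.Fin as Fin using (Fin; toℕ) renaming (zero to fz; suc to fs)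
import Data.Fin.Properties as FinP
import Data.Fin.Subset as FS
import Data.Fin.Subset.Properties as FSP
open import Data.Vec using ([]; _∷_; lookup)
import Data.Vec.Properties as VP
open import Data.Bool using (Bool; true; false; _∧_; _∨_; if_then_else_; T)
import Data.Bool.Properties as BP
open import Data.Product using (Σ; _×_; _,_; proj₁; proj₂)
open import Data.Empty using (⊥; ⊥-elim)
open import Data.Unit using (tt)
open import Function using (case_of_)
open import Relation.Binary.PropositionalEquality
open import Relation.Nullary using (¬_; Dec; yes; no; does)
open import Relation.Nullary.Decidable using (decidable-stable; ¬¬-excluded-middle; _→-dec_)

sumFin-cong : ∀ {n} {f g : Fin n → ℤ} → (∀ i → f i ≡ g i) → sumFin f ≡ sumFin g
sumFin-cong {zero}  e = refl
sumFin-cong {suc n} e = cong₂ _+_ (e fz) (sumFin-cong (λ i → e (fs i)))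

sumFin-+ : ∀ {n} (f g : Fin n → ℤ) → sumFin (λ i → f i + g i) ≡ sumFin f + sumFin g
sumFin-+ {zero}  f g = refl
sumFin-+ {suc n} f g =
  trans (cong (λ t → (f fz + g fz) + t) (sumFin-+ (λ i → f (fs i)) (λ i → g (fs i))))
        (CommSemigroupProperties.interchange ℤP.+-commutativeSemigroup (f fz) (g fz) _ _)

sumFin-* : ∀ {n} (a : ℤ) (f : Fin n → ℤ) → sumFin (λ i → a * f i) ≡ a * sumFin f
sumFin-* {zero}  a f = sym (ℤP.*-zeroʳ a)
sumFin-* {suc n} a f = trans (cong (λ t → a * f fz + t) (sumFin-* a (λ i → f (fs i))))
                             (sym (ℤP.*-distribˡ-+ a (f fz) _))

sumFin-zero : ∀ {n} (f : Fin n → ℤ) → (∀ i → f i ≡ + 0) → sumFin f ≡ + 0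
sumFin-zero {zero}  f e = refl
sumFin-zero {suc n} f e rewrite e fz =
  trans (ℤP.+-identityˡ _) (sumFin-zero (λ i → f (fs i)) (λ i → e (fs i)))

sumFin-neg : ∀ {n} (f : Fin n → ℤ) → sumFin (λ i → - f i) ≡ - sumFin f
sumFin-neg {zero}  f = refl
sumFin-neg {suc n} f = trans (cong (λ t → - f fz + t) (sumFin-neg (λ i → f (fs i))))
                             (sym (ℤP.neg-distrib-+ (f fz) _))

sumFin-comm : ∀ {n m} (h : Fin n → Fin m → ℤ) →
  sumFin (λ i → sumFin (h i)) ≡ sumFin (λ j → sumFin (λ i → h i j))
sumFin-comm {zero}  {m} h = sym (sumFin-zero {m} (λ _ → + 0) (λ _ → refl))
sumFin-comm {suc n} h =
  trans (cong (λ t → sumFin (h fz) + t) (sumFin-comm (λ i → h (fs i))))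
        (sym (sumFin-+ (h fz) (λ j → sumFin (λ i → h (fs i) j))))

x≡-x⇒x≡0 : ∀ (x : ℤ) → x ≡ - x → x ≡ + 0
x≡-x⇒x≡0 (+ zero)  e = refl
x≡-x⇒x≡0 (+ suc n) ()
x≡-x⇒x≡0 -[1+ n ]  ()

sgn-suc : ∀ a → sgn (suc a) ≡ - sgn a
sgn-suc zero          = refl
sgn-suc (suc zero)    = refl
sgn-suc (suc (suc a)) = sgn-suc a

sgn-+ : ∀ a b → sgn (a ℕ.+ b) ≡ sgn a * sgn b
sgn-+ zero    b = sym (ℤP.*-identityˡ (sgn b))
sgn-+ (suc a) b = begin
  sgn (suc (a ℕ.+ b))  ≡⟨ sgn-suc (a ℕ.+ b) ⟩
  - sgn (a ℕ.+ b)      ≡⟨ cong -_ (sgn-+ a b) ⟩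
  - (sgn a * sgn b)    ≡⟨ ℤP.neg-distribˡ-* (sgn a) (sgn b) ⟩
  - sgn a * sgn b      ≡⟨ cong (_* sgn b) (sym (sgn-suc a)) ⟩
  sgn (suc a) * sgn b  ∎
  where open ≡-Reasoning

sgn*sgn≡1 : ∀ a → sgn a * sgn a ≡ + 1
sgn*sgn≡1 zero          = refl
sgn*sgn≡1 (suc zero)    = refl
sgn*sgn≡1 (suc (suc a)) = sgn*sgn≡1 a

sgn-cancelˡ : ∀ a x → sgn a * (sgn a * x) ≡ x
sgn-cancelˡ a x = trans (sym (ℤP.*-assoc (sgn a) (sgn a) x))
                        (trans (cong (_* x) (sgn*sgn≡1 a)) (ℤP.*-identityˡ x))

-- Inclusion and disjointness stated entrywise: the case analyses below are on the
-- Booleans  lookup p i, which these forms expose directly.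
_⊆ᵉ_ : ∀ {n} → Subset n → Subset n → Set
p ⊆ᵉ q = ∀ i → lookup p i ≡ true → lookup q i ≡ true

Disjoint : ∀ {n} → Subset n → Subset n → Set
Disjoint p q = ∀ i → lookup p i ≡ true → lookup q i ≡ false

-- Opaque, so that  with disjoint? τ F  still finds the decision inside goals that
-- mention  restrict  or  extend  once these have been unfolded.
opaque
  _⊆ᵉ?_ : ∀ {n} (p q : Subset n) → Dec (p ⊆ᵉ q)
  p ⊆ᵉ? q = FinP.all? λ i → (lookup p i BP.≟ true) →-dec (lookup q i BP.≟ true)

  disjoint? : ∀ {n} (p q : Subset n) → Dec (Disjoint p q)
  disjoint? p q = FinP.all? λ i → (lookup p i BP.≟ true) →-dec (lookup q i BP.≟ false)

_≟ˢ_ : ∀ {n} (p q : Subset n) → Dec (p ≡ q)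
_≟ˢ_ = VP.≡-dec BP._≟_

⊆ᵉ⇒⊆ : ∀ {n} {p q : Subset n} → p ⊆ᵉ q → p FS.⊆ q
⊆ᵉ⇒⊆ s {x} x∈p = VP.lookup⇒[]= x _ (s x (VP.[]=⇒lookup x∈p))

⊆⇒⊆ᵉ : ∀ {n} {p q : Subset n} → p FS.⊆ q → p ⊆ᵉ q
⊆⇒⊆ᵉ s i e = VP.[]=⇒lookup (s (VP.lookup⇒[]= i _ e))

subset-ext : ∀ {n} (p q : Subset n) → (∀ i → lookup p i ≡ lookup q i) → p ≡ q
subset-ext []      []      e = refl
subset-ext (b ∷ p) (c ∷ q) e = cong₂ _∷_ (e fz) (subset-ext p q (λ i → e (fs i)))

true≢false : true ≢ false
true≢false ()

lookup≢true : ∀ {n} (p : Subset n) i → lookup p i ≢ true → lookup p i ≡ false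
lookup≢true p i ne with lookup p i
... | true  = ⊥-elim (ne refl)
... | false = refl

lookup-∪ : ∀ {n} (p q : Subset n) i → lookup (p FS.∪ q) i ≡ (lookup p i ∨ lookup q i)
lookup-∪ p q i = VP.lookup-zipWith _∨_ i p q

lookup-─ : ∀ {n} (p q : Subset n) i →
  lookup (p FS.─ q) i ≡ (if lookup q i then false else lookup p i)
lookup-─ (b ∷ p) (true  ∷ q) fz     = refl
lookup-─ (b ∷ p) (false ∷ q) fz     = refl
lookup-─ (b ∷ p) (c ∷ q)     (fs i) = lookup-─ p q i

lookup-⁅x⁆-x : ∀ {n} (v : Fin n) → lookup FS.⁅ v ⁆ v ≡ true
lookup-⁅x⁆-x fz     = refl
lookup-⁅x⁆-x (fs v) = lookup-⁅x⁆-x v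

lookup-⁅x⁆-y : ∀ {n} (v w : Fin n) → v ≢ w → lookup FS.⁅ v ⁆ w ≡ false
lookup-⁅x⁆-y fz     fz     ne = ⊥-elim (ne refl)
lookup-⁅x⁆-y fz     (fs w) ne = VP.lookup-replicate w false
lookup-⁅x⁆-y (fs v) fz     ne = refl
lookup-⁅x⁆-y (fs v) (fs w) ne = lookup-⁅x⁆-y v w (λ e → ne (cong fs e))

lookup-⁅x⁆⇒≡ : ∀ {n} (v w : Fin n) → lookup FS.⁅ v ⁆ w ≡ true → v ≡ w
lookup-⁅x⁆⇒≡ v w e with v FinP.≟ w
... | yes v≡w = v≡w
... | no  v≢w = ⊥-elim (true≢false (trans (sym e) (lookup-⁅x⁆-y v w v≢w)))

p⊆ᵉp∪q : ∀ {n} (p q : Subset n) → p ⊆ᵉ (p FS.∪ q)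
p⊆ᵉp∪q p q i e rewrite lookup-∪ p q i | e = refl

q⊆ᵉp∪q : ∀ {n} (p q : Subset n) → q ⊆ᵉ (p FS.∪ q)
q⊆ᵉp∪q p q i e rewrite lookup-∪ p q i | e with lookup p i
... | true  = refl
... | false = refl

disjoint-⁅x⁆ : ∀ {n} (τ : Subset n) v → lookup τ v ≡ false → Disjoint τ FS.⁅ v ⁆
disjoint-⁅x⁆ τ v τv i τi with v FinP.≟ i
... | yes refl = ⊥-elim (true≢false (trans (sym τi) τv))
... | no  v≢i  = lookup-⁅x⁆-y v i v≢i

∪-swap : ∀ {n} (t a b : Subset n) → (t FS.∪ a) FS.∪ b ≡ (t FS.∪ b) FS.∪ a
∪-swap t a b = trans (FSP.∪-assoc t a b)
  (trans (cong (t FS.∪_) (FSP.∪-comm a b)) (sym (FSP.∪-assoc t b a)))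

sumOver : ∀ {n} → Subset n → (Fin n → ℕ) → ℕ
sumOver []      h = 0
sumOver (b ∷ p) h = (if b then h fz else 0) ℕ.+ sumOver p (λ i → h (fs i))

sumOver-∪ : ∀ {n} (p q : Subset n) h → Disjoint p q →
  sumOver (p FS.∪ q) h ≡ sumOver p h ℕ.+ sumOver q h
sumOver-∪ []          []          h d = refl
sumOver-∪ (true ∷ p)  (true ∷ q)  h d with d fz refl
... | ()
sumOver-∪ (true ∷ p)  (false ∷ q) h d =
  trans (cong (h fz ℕ.+_) (sumOver-∪ p q _ (λ i → d (fs i))))
        (sym (ℕP.+-assoc (h fz) (sumOver p _) (sumOver q _)))
sumOver-∪ (false ∷ p) (true ∷ q)  h d =
  trans (cong (h fz ℕ.+_) (sumOver-∪ p q _ (λ i → d (fs i))))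
        (CommSemigroupProperties.x∙yz≈y∙xz ℕP.+-commutativeSemigroup (h fz) (sumOver p _) (sumOver q _))
sumOver-∪ (false ∷ p) (false ∷ q) h d = sumOver-∪ p q _ (λ i → d (fs i))

sumOver-⊥ : ∀ {n} (h : Fin n → ℕ) → sumOver FS.⊥ h ≡ 0
sumOver-⊥ {zero}  h = refl
sumOver-⊥ {suc n} h = sumOver-⊥ (λ i → h (fs i))

sumOver-⁅x⁆ : ∀ {n} (v : Fin n) h → sumOver FS.⁅ v ⁆ h ≡ h v
sumOver-⁅x⁆ {suc n} fz     h = trans (cong (h fz ℕ.+_) (sumOver-⊥ {n} _)) (ℕP.+-identityʳ (h fz))
sumOver-⁅x⁆         (fs v) h = sumOver-⁅x⁆ v (λ i → h (fs i))

∣p∣≡sumOver-1 : ∀ {n} (p : Subset n) → ∣ p ∣ ≡ sumOver p (λ _ → 1)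
∣p∣≡sumOver-1 []          = refl
∣p∣≡sumOver-1 (true ∷ p)  = cong suc (∣p∣≡sumOver-1 p)
∣p∣≡sumOver-1 (false ∷ p) = ∣p∣≡sumOver-1 p

∣p∪q∣≡∣p∣+∣q∣ : ∀ {n} (p q : Subset n) → Disjoint p q → ∣ p FS.∪ q ∣ ≡ ∣ p ∣ ℕ.+ ∣ q ∣
∣p∪q∣≡∣p∣+∣q∣ p q d = trans (∣p∣≡sumOver-1 (p FS.∪ q)) (trans (sumOver-∪ p q _ d)
  (sym (cong₂ ℕ._+_ (∣p∣≡sumOver-1 p) (∣p∣≡sumOver-1 q))))

∣p∪⁅x⁆∣≡1+∣p∣ : ∀ {n} (σ : Subset n) v → lookup σ v ≡ false → ∣ σ FS.∪ FS.⁅ v ⁆ ∣ ≡ suc ∣ σ ∣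
∣p∪⁅x⁆∣≡1+∣p∣ σ v σv =
  trans (∣p∪q∣≡∣p∣+∣q∣ σ FS.⁅ v ⁆ (disjoint-⁅x⁆ σ v σv))
        (trans (cong (∣ σ ∣ ℕ.+_) (FSP.∣⁅x⁆∣≡1 v)) (ℕP.+-comm ∣ σ ∣ 1))

∣p∣≤∣q∣ : ∀ {n} {p q : Subset n} → p ⊆ᵉ q → ∣ p ∣ ℕ.≤ ∣ q ∣
∣p∣≤∣q∣ {p = p} {q} s = FSP.p⊆q⇒∣p∣≤∣q∣ {p = p} {q} (⊆ᵉ⇒⊆ s)

⊆ᵉ∧≢⇒∣p∣<∣q∣ : ∀ {n} (p q : Subset n) → p ⊆ᵉ q → p ≢ q → ∣ p ∣ ℕ.< ∣ q ∣
⊆ᵉ∧≢⇒∣p∣<∣q∣ []          []          s ne = ⊥-elim (ne refl)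
⊆ᵉ∧≢⇒∣p∣<∣q∣ (true ∷ p)  (false ∷ q) s ne with s fz refl
... | ()
⊆ᵉ∧≢⇒∣p∣<∣q∣ (true ∷ p)  (true ∷ q)  s ne =
  ℕ.s≤s (⊆ᵉ∧≢⇒∣p∣<∣q∣ p q (λ i → s (fs i)) (λ e → ne (cong (true ∷_) e)))
⊆ᵉ∧≢⇒∣p∣<∣q∣ (false ∷ p) (false ∷ q) s ne =
  ⊆ᵉ∧≢⇒∣p∣<∣q∣ p q (λ i → s (fs i)) (λ e → ne (cong (false ∷_) e))
⊆ᵉ∧≢⇒∣p∣<∣q∣ (false ∷ p) (true ∷ q)  s ne = ℕ.s≤s (∣p∣≤∣q∣ {p = p} {q} (λ i → s (fs i)))

two-entries⇒2≤∣p∣ : ∀ {n} (p : Subset n) x y →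
  lookup p x ≡ true → lookup p y ≡ true → x ≢ y → 2 ℕ.≤ ∣ p ∣
two-entries⇒2≤∣p∣ p x y px py x≢y =
  subst (ℕ._≤ ∣ p ∣) (trans (∣p∪⁅x⁆∣≡1+∣p∣ FS.⁅ x ⁆ y (lookup-⁅x⁆-y x y x≢y)) (cong suc (FSP.∣⁅x⁆∣≡1 x)))
        (∣p∣≤∣q∣ {p = FS.⁅ x ⁆ FS.∪ FS.⁅ y ⁆} {p} pair⊆p)
  where
  pair⊆p : (FS.⁅ x ⁆ FS.∪ FS.⁅ y ⁆) ⊆ᵉ p
  pair⊆p i e rewrite lookup-∪ FS.⁅ x ⁆ FS.⁅ y ⁆ i with lookup FS.⁅ x ⁆ i in xi
  ... | true  rewrite sym (lookup-⁅x⁆⇒≡ x i xi) = px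
  ... | false rewrite sym (lookup-⁅x⁆⇒≡ y i e)  = py

nonzero⇒entry : ∀ {n} (p : Subset n) → 1 ℕ.≤ ∣ p ∣ → Σ (Fin n) λ i → lookup p i ≡ true
nonzero⇒entry (true ∷ p)  h = fz , refl
nonzero⇒entry (false ∷ p) h with nonzero⇒entry p h
... | i , e = fs i , e

lookup-─⇒ : ∀ {n} (p q : Subset n) i → lookup (p FS.─ q) i ≡ true →
  lookup p i ≡ true × lookup q i ≡ false
lookup-─⇒ p q i e rewrite lookup-─ p q i with lookup q i
... | true  = ⊥-elim (true≢false (sym e))
... | false = e , refl

lookup-─⇐ : ∀ {n} (p q : Subset n) i → lookup p i ≡ true → lookup q i ≡ false →
  lookup (p FS.─ q) i ≡ true
lookup-─⇐ p q i pi qi rewrite lookup-─ p q i | qi = pi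

p─q⊆ᵉr⇒p⊆ᵉr∪q : ∀ {n} (p q r : Subset n) → (p FS.─ q) ⊆ᵉ r → p ⊆ᵉ (r FS.∪ q)
p─q⊆ᵉr⇒p⊆ᵉr∪q p q r s i pi with lookup q i in qi
... | true  = q⊆ᵉp∪q r q i qi
... | false = p⊆ᵉp∪q r q i (s i (lookup-─⇐ p q i pi qi))

p⊆ᵉr∪q⇒p─q⊆ᵉr : ∀ {n} (p q r : Subset n) → p ⊆ᵉ (r FS.∪ q) → (p FS.─ q) ⊆ᵉ r
p⊆ᵉr∪q⇒p─q⊆ᵉr p q r s i e with lookup-─⇒ p q i e
... | pi , qi with trans (sym (lookup-∪ r q i)) (s i pi)
...   | ri∨qi rewrite qi with lookup r i
...     | true = refl

∣p─q∣≡0⇒p⊆ᵉq : ∀ {n} (p q : Subset n) → ∣ p FS.─ q ∣ ≡ 0 → p ⊆ᵉ q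
∣p─q∣≡0⇒p⊆ᵉq p q ∣p─q∣≡0 i pi with lookup q i in qi
... | true  = refl
... | false = ⊥-elim (ℕP.<-irrefl (sym ∣p─q∣≡0)
  (subst (ℕ._≤ ∣ p FS.─ q ∣) (FSP.∣⁅x⁆∣≡1 i)
    (∣p∣≤∣q∣ {p = FS.⁅ i ⁆} {p FS.─ q} λ j e →
      subst (λ k → lookup (p FS.─ q) k ≡ true) (lookup-⁅x⁆⇒≡ i j e) (lookup-─⇐ p q i pi qi))))

∣p∣≡1⇒⊆ᵉ⁅x⁆ : ∀ {n} (p : Subset n) x → ∣ p ∣ ≡ 1 → lookup p x ≡ true → p ⊆ᵉ FS.⁅ x ⁆
∣p∣≡1⇒⊆ᵉ⁅x⁆ p x ∣p∣≡1 px y py with y FinP.≟ x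
... | yes refl = lookup-⁅x⁆-x y
... | no  y≢x  = ⊥-elim (ℕP.<-irrefl (sym ∣p∣≡1) (two-entries⇒2≤∣p∣ p y x py px y≢x))

Minimal : ∀ {n} → (Subset n → Set) → Subset n → Set
Minimal P G = P G × (∀ G′ → P G′ → G′ FS.⊆ G → G′ ≡ G)

-- For an arbitrary P the descent cannot decide whether a smaller P-set exists, hence ¬ ¬;
-- the conclusion is only ever used to derive ⊥.
¬¬minimal⊆ᵉ : ∀ {n} (P : Subset n → Set) G → P G → ¬ ¬ (Σ (Subset n) λ G′ → Minimal P G′ × G′ ⊆ᵉ G)
¬¬minimal⊆ᵉ {n} P G PG = below-bound (suc ∣ G ∣) G ℕP.≤-refl PG
  where
  below-bound : ∀ m G → ∣ G ∣ ℕ.< m → P G → ¬ ¬ (Σ (Subset n) λ G′ → Minimal P G′ × G′ ⊆ᵉ G)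
  below-bound zero    G ()   PG
  below-bound (suc m) G ∣G∣<m PG no-minimal =
    ¬¬-excluded-middle {A = Σ (Subset n) λ G′ → P G′ × G′ ⊆ᵉ G × G′ ≢ G} λ where
    (yes (G′ , PG′ , G′⊆G , G′≢G)) →
      below-bound m G′ (ℕP.<-≤-trans (⊆ᵉ∧≢⇒∣p∣<∣q∣ G′ G G′⊆G G′≢G) (ℕP.≤-pred ∣G∣<m)) PG′
        (λ (G″ , minG″ , G″⊆G′) → no-minimal (G″ , minG″ , λ i e → G′⊆G i (G″⊆G′ i e)))
    (no ∄smaller) → no-minimal (G , (PG , λ G′ PG′ G′⊆G →
      decidable-stable (G′ ≟ˢ G) (λ G′≢G → ∄smaller (G′ , PG′ , ⊆⇒⊆ᵉ G′⊆G , G′≢G))) , λ _ e → e)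

isBelow : ∀ {n} → Fin n → Fin n → ℕ
isBelow u v = if toℕ u <ᵇ toℕ v then 1 else 0

below≡sumOver : ∀ {n} (τ : Subset n) v → below τ v ≡ sumOver τ (λ u → isBelow u v)
below≡sumOver τ v = cong ℤ.∣_∣ (sumIndicator τ (λ u → toℕ u <ᵇ toℕ v))
  where
  sumIndicator : ∀ {n} (τ : Subset n) (g : Fin n → Bool) →
    sumFin (λ u → if lookup τ u ∧ g u then + 1 else + 0) ≡ + sumOver τ (λ u → if g u then 1 else 0)
  sumIndicator []          g = refl
  sumIndicator (true ∷ τ)  g rewrite sumIndicator τ (λ i → g (fs i)) with g fz
  ... | true  = refl
  ... | false = refl
  sumIndicator (false ∷ τ) g rewrite sumIndicator τ (λ i → g (fs i)) = refl

below-∪ : ∀ {n} (τ ρ : Subset n) v → Disjoint τ ρ → below (τ FS.∪ ρ) v ≡ below τ v ℕ.+ below ρ v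
below-∪ τ ρ v d = trans (below≡sumOver (τ FS.∪ ρ) v) (trans (sumOver-∪ τ ρ _ d)
  (sym (cong₂ ℕ._+_ (below≡sumOver τ v) (below≡sumOver ρ v))))

below-∪⁅x⁆ : ∀ {n} (τ : Subset n) v w → lookup τ v ≡ false →
  below (τ FS.∪ FS.⁅ v ⁆) w ≡ below τ w ℕ.+ isBelow v w
below-∪⁅x⁆ τ v w τv = trans (below-∪ τ _ w (disjoint-⁅x⁆ τ v τv))
  (cong (below τ w ℕ.+_) (trans (below≡sumOver FS.⁅ v ⁆ w) (sumOver-⁅x⁆ v (λ u → isBelow u w))))

sgn-isBelow-antisym : ∀ {n} (v w : Fin n) → v ≢ w → sgn (isBelow v w) ≡ - sgn (isBelow w v)
sgn-isBelow-antisym v w v≢w with toℕ v <ᵇ toℕ w in v<w | toℕ w <ᵇ toℕ v in w<v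
... | true  | true  = ⊥-elim (ℕP.<-asym (<ᵇ⇒< v w v<w) (<ᵇ⇒< w v w<v))
  where
  <ᵇ⇒< : ∀ x y → (toℕ x <ᵇ toℕ y) ≡ true → toℕ x ℕ.< toℕ y
  <ᵇ⇒< x y e = ℕP.<ᵇ⇒< (toℕ x) (toℕ y) (subst T (sym e) tt)
... | true  | false = refl
... | false | true  = refl
... | false | false = ⊥-elim (v≢w (FinP.toℕ-injective (ℕP.≤-antisym (≮ w v w<v) (≮ v w v<w))))
  where
  ≮ : ∀ x y → (toℕ x <ᵇ toℕ y) ≡ false → toℕ y ℕ.≤ toℕ x
  ≮ x y e = ℕP.≮⇒≥ λ x<y → subst T e (ℕP.<⇒<ᵇ x<y)

Chain : ℕ → Set
Chain n = Subset n → ℤ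

IsCycle : ∀ {n} → Chain n → Set
IsCycle c = ∀ τ → ∂ c τ ≡ + 0

_+ᶜ_ _-ᶜ_ : ∀ {n} → Chain n → Chain n → Chain n
(x +ᶜ y) σ = x σ + y σ
(x -ᶜ y) σ = x σ - y σ

∂-summand : ∀ {n} → Chain n → Subset n → Fin n → ℤ
∂-summand x τ v = if lookup τ v then + 0 else sgn (below τ v) * x (τ FS.∪ FS.⁅ v ⁆)

∂-cong : ∀ {n} (x y : Chain n) → (∀ σ → x σ ≡ y σ) → ∀ τ → ∂ x τ ≡ ∂ y τ
∂-cong x y e τ = sumFin-cong λ v → cong (λ t → if lookup τ v then + 0 else sgn (below τ v) * t) (e _)

∂-+ : ∀ {n} (x y : Chain n) τ → ∂ (x +ᶜ y) τ ≡ ∂ x τ + ∂ y τ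
∂-+ x y τ = trans (sumFin-cong summand-+) (sumFin-+ (∂-summand x τ) (∂-summand y τ))
  where
  summand-+ : ∀ v → ∂-summand (x +ᶜ y) τ v ≡ ∂-summand x τ v + ∂-summand y τ v
  summand-+ v with lookup τ v
  ... | true  = refl
  ... | false = ℤP.*-distribˡ-+ (sgn (below τ v)) _ _

∂-neg : ∀ {n} (x : Chain n) τ → ∂ (λ σ → - x σ) τ ≡ - ∂ x τ
∂-neg x τ = trans (sumFin-cong summand-neg) (sumFin-neg (∂-summand x τ))
  where
  summand-neg : ∀ v → ∂-summand (λ σ → - x σ) τ v ≡ - ∂-summand x τ v
  summand-neg v with lookup τ v
  ... | true  = refl
  ... | false = sym (ℤP.neg-distribʳ-* (sgn (below τ v)) _)

∂-- : ∀ {n} (x y : Chain n) τ → ∂ (x -ᶜ y) τ ≡ ∂ x τ - ∂ y τ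
∂-- x y τ = trans (∂-+ x (λ σ → - y σ) τ) (cong (λ t → ∂ x τ + t) (∂-neg y τ))

module _ {n} (c : Chain n) (τ : Subset n) where

  private
    ∂∂-summand : Fin n → Fin n → ℤ
    ∂∂-summand v w = if lookup τ v then + 0 else sgn (below τ v) * ∂-summand c (τ FS.∪ FS.⁅ v ⁆) w

    ∂∂-as-double-sum : ∂ (∂ c) τ ≡ sumFin (λ v → sumFin (∂∂-summand v))
    ∂∂-as-double-sum = sumFin-cong inner
      where
      inner : ∀ v → ∂-summand (∂ c) τ v ≡ sumFin (∂∂-summand v)
      inner v with lookup τ v
      ... | true  = sym (sumFin-zero {n} (λ _ → + 0) (λ _ → refl))
      ... | false = sym (sumFin-* (sgn (below τ v)) (∂-summand c (τ FS.∪ FS.⁅ v ⁆)))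

    ∂∂-summand-antisym : ∀ v w → ∂∂-summand v w ≡ - ∂∂-summand w v
    ∂∂-summand-antisym v w with lookup τ v in τv | lookup τ w in τw
    ... | true  | true  = refl
    ... | true  | false rewrite lookup-∪ τ FS.⁅ w ⁆ v | τv = sym (-[s*0]≡0 (sgn (below τ w)))
      where -[s*0]≡0 : ∀ s → - (s * + 0) ≡ + 0
            -[s*0]≡0 s rewrite ℤP.*-zeroʳ s = refl
    ... | false | true  rewrite lookup-∪ τ FS.⁅ v ⁆ w | τw = ℤP.*-zeroʳ (sgn (below τ v))
    ... | false | false with v FinP.≟ w
    ...   | yes refl rewrite lookup-∪ τ FS.⁅ v ⁆ v | τv | lookup-⁅x⁆-x v
                     | ℤP.*-zeroʳ (sgn (below τ v)) = refl
    ...   | no  v≢w  rewrite lookup-∪ τ FS.⁅ v ⁆ w | τw | lookup-⁅x⁆-y v w v≢w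
                     | lookup-∪ τ FS.⁅ w ⁆ v | τv | lookup-⁅x⁆-y w v (≢-sym v≢w)
                     | below-∪⁅x⁆ τ v w τv | below-∪⁅x⁆ τ w v τw
                     | sgn-+ (below τ w) (isBelow v w) | sgn-+ (below τ v) (isBelow w v)
                     | sgn-isBelow-antisym v w v≢w | ∪-swap τ FS.⁅ v ⁆ FS.⁅ w ⁆
                     = reorder (sgn (below τ v)) (sgn (below τ w)) (sgn (isBelow w v))
                               (c ((τ FS.∪ FS.⁅ w ⁆) FS.∪ FS.⁅ v ⁆))
      where reorder : ∀ (a b l x : ℤ) → a * ((b * (- l)) * x) ≡ - (b * ((a * l) * x))
            reorder = solve-∀

  -- The double sum equals its own negative by the antisymmetry of its summand.
  ∂∘∂≡0 : ∂ (∂ c) τ ≡ + 0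
  ∂∘∂≡0 = x≡-x⇒x≡0 _ (begin
    ∂ (∂ c) τ
      ≡⟨ ∂∂-as-double-sum ⟩
    sumFin (λ v → sumFin (∂∂-summand v))
      ≡⟨ sumFin-cong (λ v → sumFin-cong (∂∂-summand-antisym v)) ⟩
    sumFin (λ v → sumFin (λ w → - ∂∂-summand w v))
      ≡⟨ sumFin-cong (λ v → sumFin-neg (λ w → ∂∂-summand w v)) ⟩
    sumFin (λ v → - sumFin (λ w → ∂∂-summand w v))
      ≡⟨ sumFin-neg (λ v → sumFin (λ w → ∂∂-summand w v)) ⟩
    - sumFin (λ v → sumFin (λ w → ∂∂-summand w v))
      ≡⟨ cong -_ (sym (sumFin-comm ∂∂-summand)) ⟩
    - sumFin (λ w → sumFin (∂∂-summand w))
      ≡⟨ cong -_ (sym ∂∂-as-double-sum) ⟩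
    - ∂ (∂ c) τ
      ∎)
    where open ≡-Reasoning

DownClosed : ∀ {n} → (Subset n → Set) → Set
DownClosed Δ = ∀ σ v → Δ (σ FS.∪ FS.⁅ v ⁆) → Δ σ

Ind-downClosed : ∀ {n} (W : Fin n → Set) (Ed : Subset n → Set) → DownClosed (Ind W Ed)
Ind-downClosed W Ed σ v (vs , es) =
  (λ x x∈σ → vs x (⊆ᵉ⇒⊆ (p⊆ᵉp∪q σ _) x∈σ)) ,
  (λ E eE E⊆σ → es E eE (λ x∈E → ⊆ᵉ⇒⊆ (p⊆ᵉp∪q σ _) (E⊆σ x∈E)))

IsChain-∂ : ∀ {n} (Δ : Subset n → Set) → DownClosed Δ →
  ∀ k d → IsChain Δ (suc k) d → IsChain Δ k (∂ d)
IsChain-∂ Δ down k d dc σ σ∉Δₖ = sumFin-zero (∂-summand d σ) summand≡0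
  where
  summand≡0 : ∀ v → ∂-summand d σ v ≡ + 0
  summand≡0 v with lookup σ v in σv
  ... | true  = refl
  ... | false rewrite dc (σ FS.∪ FS.⁅ v ⁆)
                (λ (σv∈Δ , ∣σv∣≡) → σ∉Δₖ (down σ v σv∈Δ ,
                   ℕP.suc-injective (trans (sym (∣p∪⁅x⁆∣≡1+∣p∣ σ v σv)) ∣σv∣≡)))
              = ℤP.*-zeroʳ (sgn (below σ v))

IsChain-+ᶜ : ∀ {n} (Δ : Subset n → Set) k {x y} → IsChain Δ k x → IsChain Δ k y → IsChain Δ k (x +ᶜ y)
IsChain-+ᶜ Δ k xc yc σ h rewrite xc σ h | yc σ h = refl

IsChain--ᶜ : ∀ {n} (Δ : Subset n → Set) k {x y} → IsChain Δ k x → IsChain Δ k y → IsChain Δ k (x -ᶜ y)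
IsChain--ᶜ Δ k xc yc σ h rewrite xc σ h | yc σ h = refl

IsChain-mono : ∀ {n} {Δ Δ′ : Subset n → Set} → (∀ σ → Δ σ → Δ′ σ) →
  ∀ k {x} → IsChain Δ k x → IsChain Δ′ k x
IsChain-mono Δ⊆Δ′ k xc σ h = xc σ (λ (σ∈Δ , ∣σ∣≡k) → h (Δ⊆Δ′ σ σ∈Δ , ∣σ∣≡k))

module Link {n} (F : Subset n) where

  -- The sign of the shuffle that sorts the concatenation of τ and F.
  ε : Subset n → ℤ
  ε τ = sgn (sumOver τ (λ u → below F u))

  ε-cancelˡ : ∀ τ a → ε τ * (ε τ * a) ≡ a
  ε-cancelˡ τ = sgn-cancelˡ (sumOver τ (λ u → below F u))

  ε-∪⁅x⁆ : ∀ τ v → lookup τ v ≡ false → ε (τ FS.∪ FS.⁅ v ⁆) ≡ ε τ * sgn (below F v)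
  ε-∪⁅x⁆ τ v τv = trans
    (cong sgn (trans (sumOver-∪ τ FS.⁅ v ⁆ _ (disjoint-⁅x⁆ τ v τv))
                     (cong (sumOver τ (λ u → below F u) ℕ.+_) (sumOver-⁅x⁆ v (λ u → below F u)))))
    (sgn-+ (sumOver τ (λ u → below F u)) (below F v))

  restrict : Chain n → Chain n
  restrict x τ = if does (disjoint? τ F) then ε τ * x (τ FS.∪ F) else + 0

  extend : Chain n → Chain n
  extend y σ = if does (F ⊆ᵉ? σ) then ε (σ FS.─ F) * y (σ FS.─ F) else + 0

  restrict-disjoint : ∀ x τ → Disjoint τ F → restrict x τ ≡ ε τ * x (τ FS.∪ F)
  restrict-disjoint x τ d with disjoint? τ F
  ... | yes _ = refl
  ... | no ¬d = ⊥-elim (¬d d)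

  restrict-nondisjoint : ∀ x τ → ¬ Disjoint τ F → restrict x τ ≡ + 0
  restrict-nondisjoint x τ ¬d with disjoint? τ F
  ... | yes d = ⊥-elim (¬d d)
  ... | no _  = refl

  extend-⊇ : ∀ y σ → F ⊆ᵉ σ → extend y σ ≡ ε (σ FS.─ F) * y (σ FS.─ F)
  extend-⊇ y σ s with F ⊆ᵉ? σ
  ... | yes _ = refl
  ... | no ¬s = ⊥-elim (¬s s)

  [τ∪F]─F≡τ : ∀ τ → Disjoint τ F → (τ FS.∪ F) FS.─ F ≡ τ
  [τ∪F]─F≡τ τ d = subset-ext _ _ entry
    where
    entry : ∀ i → lookup ((τ FS.∪ F) FS.─ F) i ≡ lookup τ i
    entry i rewrite lookup-─ (τ FS.∪ F) F i | lookup-∪ τ F i with lookup τ i in τi | lookup F i in Fi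
    ... | true  | true  = ⊥-elim (true≢false (trans (sym Fi) (d i τi)))
    ... | true  | false = refl
    ... | false | true  = refl
    ... | false | false = refl

  [σ─F]∪F≡σ : ∀ σ → F ⊆ᵉ σ → (σ FS.─ F) FS.∪ F ≡ σ
  [σ─F]∪F≡σ σ s = subset-ext _ _ entry
    where
    entry : ∀ i → lookup ((σ FS.─ F) FS.∪ F) i ≡ lookup σ i
    entry i rewrite lookup-∪ (σ FS.─ F) F i | lookup-─ σ F i with lookup F i in Fi
    ... | true  = sym (s i Fi)
    ... | false with lookup σ i
    ...   | true  = refl
    ...   | false = refl

  disjoint-─ : ∀ σ → Disjoint (σ FS.─ F) F
  disjoint-─ σ i e rewrite lookup-─ σ F i with lookup F i
  ... | true  = ⊥-elim (true≢false (sym e))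
  ... | false = refl

  disjoint-∪⁅x⁆ : ∀ τ v → Disjoint τ F → lookup F v ≡ false → Disjoint (τ FS.∪ FS.⁅ v ⁆) F
  disjoint-∪⁅x⁆ τ v d Fv i e rewrite lookup-∪ τ FS.⁅ v ⁆ i with lookup τ i in τi
  ... | true  = d i τi
  ... | false rewrite sym (lookup-⁅x⁆⇒≡ v i e) = Fv

  ∂-restrict : ∀ x τ → Disjoint τ F → ∂ (restrict x) τ ≡ ε τ * ∂ x (τ FS.∪ F)
  ∂-restrict x τ d = trans (sumFin-cong summand) (sumFin-* (ε τ) (∂-summand x (τ FS.∪ F)))
    where
    reorder : ∀ (a e b x : ℤ) → a * ((e * b) * x) ≡ e * ((a * b) * x)
    reorder = solve-∀
    summand : ∀ v → ∂-summand (restrict x) τ v ≡ ε τ * ∂-summand x (τ FS.∪ F) v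
    summand v with lookup τ v in τv
    ... | true rewrite lookup-∪ τ F v | τv = sym (ℤP.*-zeroʳ (ε τ))
    ... | false with lookup F v in Fv
    ...   | true rewrite lookup-∪ τ F v | τv | Fv
             | restrict-nondisjoint x (τ FS.∪ FS.⁅ v ⁆)
                 (λ d′ → true≢false (trans (sym Fv) (d′ v (q⊆ᵉp∪q τ FS.⁅ v ⁆ v (lookup-⁅x⁆-x v)))))
             = trans (ℤP.*-zeroʳ (sgn (below τ v))) (sym (ℤP.*-zeroʳ (ε τ)))
    ...   | false rewrite lookup-∪ τ F v | τv | Fv
             | restrict-disjoint x (τ FS.∪ FS.⁅ v ⁆) (disjoint-∪⁅x⁆ τ v d Fv)
             | below-∪ τ F v d | ε-∪⁅x⁆ τ v τv | sgn-+ (below τ v) (below F v)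
             | ∪-swap τ FS.⁅ v ⁆ F
             = reorder (sgn (below τ v)) (ε τ) (sgn (below F v)) (x ((τ FS.∪ F) FS.∪ FS.⁅ v ⁆))

  ∂-restrict-nondisjoint : ∀ x τ → ¬ Disjoint τ F → ∂ (restrict x) τ ≡ + 0
  ∂-restrict-nondisjoint x τ ¬d = sumFin-zero (∂-summand (restrict x) τ) summand≡0
    where
    summand≡0 : ∀ v → ∂-summand (restrict x) τ v ≡ + 0
    summand≡0 v with lookup τ v
    ... | true  = refl
    ... | false rewrite restrict-nondisjoint x (τ FS.∪ FS.⁅ v ⁆)
                          (λ d → ¬d (λ i e → d i (p⊆ᵉp∪q τ FS.⁅ v ⁆ i e)))
                = ℤP.*-zeroʳ (sgn (below τ v))

  ∂-at-∪F : ∀ x τ → Disjoint τ F → ∂ x (τ FS.∪ F) ≡ ε τ * ∂ (restrict x) τ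
  ∂-at-∪F x τ d = sym (trans (cong (ε τ *_) (∂-restrict x τ d)) (ε-cancelˡ τ _))

  restrict∘extend : ∀ y τ → Disjoint τ F → restrict (extend y) τ ≡ y τ
  restrict∘extend y τ d rewrite restrict-disjoint (extend y) τ d
    | extend-⊇ y (τ FS.∪ F) (q⊆ᵉp∪q τ F) | [τ∪F]─F≡τ τ d = ε-cancelˡ τ (y τ)

  extend-at-∪F : ∀ y τ → Disjoint τ F → extend y (τ FS.∪ F) ≡ ε τ * y τ
  extend-at-∪F y τ d rewrite extend-⊇ y (τ FS.∪ F) (q⊆ᵉp∪q τ F) | [τ∪F]─F≡τ τ d = refl

module Complexes {n} (C : Hypergraph n) (F : Subset n) (F∈C : Edge C F) where

  IndC IndC∖F IndC∶F : Subset n → Set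
  IndC   = Ind allV (Edge C)
  IndC∖F = Ind allV (minusEdges C F)
  IndC∶F = Ind (colonVerts C F) (colonEdges C F)

  IndC⇒∌F : ∀ σ → IndC σ → ¬ F ⊆ᵉ σ
  IndC⇒∌F σ (_ , es) F⊆σ = es F F∈C (⊆ᵉ⇒⊆ F⊆σ)

  IndC⊆IndC∖F : ∀ σ → IndC σ → IndC∖F σ
  IndC⊆IndC∖F σ (vs , es) = vs , λ E (E∈C , _) → es E E∈C

  IndC∖F∧∌F⇒IndC : ∀ σ → IndC∖F σ → ¬ F ⊆ᵉ σ → IndC σ
  IndC∖F∧∌F⇒IndC σ (vs , es) F⊈σ = vs , λ E E∈C E⊆σ → case E ≟ˢ F of λ where
    (yes refl) → F⊈σ (⊆⇒⊆ᵉ E⊆σ)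
    (no E≢F)   → es E (E∈C , E≢F) E⊆σ

  IndC∶F⇒disjoint : ∀ τ → IndC∶F τ → Disjoint τ F
  IndC∶F⇒disjoint τ (vs , _) i τi =
    lookup≢true F i (λ Fi → proj₁ (vs i (VP.lookup⇒[]= i τ τi)) (VP.lookup⇒[]= i F Fi))

  IndC∖F-∪F⇒IndC∶F : ∀ τ → IndC∖F (τ FS.∪ F) → Disjoint τ F → IndC∶F τ
  IndC∖F-∪F⇒IndC∶F τ (_ , es) d = vertices , edges
    where
    vertices : ∀ x → x FS.∈ τ → colonVerts C F x
    vertices x x∈τ = x∉F , x∉N
      where
      τx : lookup τ x ≡ true
      τx = VP.[]=⇒lookup x∈τ
      x∉F : x FS.∉ F
      x∉F x∈F = true≢false (trans (sym (VP.[]=⇒lookup x∈F)) (d x τx))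
      x∉N : ¬ inN C F x
      x∉N (E , E∈C , ∣E─F∣≡1 , x∈E─F) =
        es E (E∈C , E≢F) (⊆ᵉ⇒⊆ (p─q⊆ᵉr⇒p⊆ᵉr∪q E F τ E─F⊆τ))
        where
        E─Fx : lookup (E FS.─ F) x ≡ true
        E─Fx = VP.[]=⇒lookup x∈E─F
        E≢F : E ≢ F
        E≢F refl with lookup-─⇒ F F x E─Fx
        ... | Fx , ¬Fx = true≢false (trans (sym Fx) ¬Fx)
        E─F⊆τ : (E FS.─ F) ⊆ᵉ τ
        E─F⊆τ y E─Fy = subst (λ z → lookup τ z ≡ true)
          (lookup-⁅x⁆⇒≡ x y (∣p∣≡1⇒⊆ᵉ⁅x⁆ (E FS.─ F) x ∣E─F∣≡1 E─Fx y E─Fy)) τx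
    edges : ∀ G → colonEdges C F G → ¬ (G FS.⊆ τ)
    edges G ((E , E∈C∖F , refl , _) , _) G⊆τ = es E E∈C∖F (⊆ᵉ⇒⊆ (p─q⊆ᵉr⇒p⊆ᵉr∪q E F τ (⊆⇒⊆ᵉ G⊆τ)))

  -- An edge E of C − F inside τ ∪ F leaves G = E ∖ F inside τ.  According to |G|, either
  -- E ⊆ F (impossible for an edge other than F), or G is a vertex of N_C(F), or G is
  -- a candidate edge of C : F, hence contains an edge of C : F.
  IndC∶F⇒IndC∖F-∪F : ∀ τ → IndC∶F τ → IndC∖F (τ FS.∪ F)
  IndC∶F⇒IndC∖F-∪F τ (vs , es) = (λ _ _ → tt) , λ E E∈C∖F E⊆τ∪F →
    no-edge E E∈C∖F (p⊆ᵉr∪q⇒p─q⊆ᵉr E F τ (⊆⇒⊆ᵉ E⊆τ∪F)) ∣ E FS.─ F ∣ refl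
    where
    no-edge : ∀ E → minusEdges C F E → (E FS.─ F) ⊆ᵉ τ → ∀ m → ∣ E FS.─ F ∣ ≡ m → ⊥
    no-edge E (E∈C , E≢F) G⊆τ zero ∣G∣≡0 =
      E≢F (incomparable C E F E∈C F∈C (⊆ᵉ⇒⊆ (∣p─q∣≡0⇒p⊆ᵉq E F ∣G∣≡0)))
    no-edge E (E∈C , E≢F) G⊆τ (suc zero) ∣G∣≡1 =
      proj₂ (vs x (VP.lookup⇒[]= x τ (G⊆τ x Gx))) (E , E∈C , ∣G∣≡1 , VP.lookup⇒[]= x _ Gx)
      where
      entry : Σ (Fin n) λ i → lookup (E FS.─ F) i ≡ true
      entry = nonzero⇒entry (E FS.─ F) (ℕP.≤-reflexive (sym ∣G∣≡1))
      x : Fin n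
      x = proj₁ entry
      Gx : lookup (E FS.─ F) x ≡ true
      Gx = proj₂ entry
    no-edge E (E∈C , E≢F) G⊆τ (suc (suc m)) ∣G∣≡2+m =
      ¬¬minimal⊆ᵉ (colonCand C F) (E FS.─ F) candidate
        λ (G′ , G′∈C∶F , G′⊆G) → es G′ G′∈C∶F (⊆ᵉ⇒⊆ λ i e → G⊆τ i (G′⊆G i e))
      where
      candidate : colonCand C F (E FS.─ F)
      candidate = E , (E∈C , E≢F) , refl , subst (2 ℕ.≤_) (sym ∣G∣≡2+m) (ℕ.s≤s (ℕ.s≤s ℕ.z≤n))
                , λ x x∈G → proj₂ (vs x (VP.lookup⇒[]= x τ (G⊆τ x (VP.[]=⇒lookup x∈G))))

module Chase {n} (C : Hypergraph n) (F : Subset n) (F∈C : Edge C F) where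
  open Link F
  open Complexes C F F∈C

  f : ℕ
  f = ∣ F ∣

  restrict-IsChain : ∀ {m k} t → k ≡ m ℕ.+ f → IsChain IndC∖F k t → IsChain IndC∶F m (restrict t)
  restrict-IsChain {m} t refl tc τ τ∉K with disjoint? τ F
  ... | no  _ = refl
  ... | yes d rewrite tc (τ FS.∪ F) (λ (τ∪F∈B , ∣τ∪F∣≡) → τ∉K (IndC∖F-∪F⇒IndC∶F τ τ∪F∈B d ,
                        ℕP.+-cancelʳ-≡ f ∣ τ ∣ m (trans (sym (∣p∪q∣≡∣p∣+∣q∣ τ F d)) ∣τ∪F∣≡)))
              = ℤP.*-zeroʳ (ε τ)

  extend-IsChain : ∀ {m k} y → k ≡ m ℕ.+ f → IsChain IndC∶F m y → IsChain IndC∖F k (extend y)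
  extend-IsChain y refl yc σ σ∉B with F ⊆ᵉ? σ
  ... | no  _   = refl
  ... | yes F⊆σ rewrite yc (σ FS.─ F) (λ (σ─F∈K , ∣σ─F∣≡) → σ∉B
                          (subst IndC∖F ([σ─F]∪F≡σ σ F⊆σ) (IndC∶F⇒IndC∖F-∪F _ σ─F∈K) ,
                           trans (cong ∣_∣ (sym ([σ─F]∪F≡σ σ F⊆σ)))
                                 (trans (∣p∪q∣≡∣p∣+∣q∣ (σ FS.─ F) F (disjoint-─ σ)) (cong (ℕ._+ f) ∣σ─F∣≡))))
                = ℤP.*-zeroʳ (ε (σ FS.─ F))

  IndC∶F-chain-nondisjoint : ∀ m y → IsChain IndC∶F m y → ∀ τ → ¬ Disjoint τ F → y τ ≡ + 0
  IndC∶F-chain-nondisjoint m y yc τ ¬d = yc τ (λ (τ∈K , _) → ¬d (IndC∶F⇒disjoint τ τ∈K))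

  IndC∖F-chain⇒IndC-chain : ∀ k x → IsChain IndC∖F k x → (∀ σ → F ⊆ᵉ σ → x σ ≡ + 0) → IsChain IndC k x
  IndC∖F-chain⇒IndC-chain k x xc x∌F σ σ∉A = decidable-stable (x σ ℤ.≟ + 0) λ xσ≢0 →
    ¬¬-excluded-middle {A = IndC∖F σ × ∣ σ ∣ ≡ k} λ where
      (yes (σ∈B , ∣σ∣≡k)) → σ∉A (IndC∖F∧∌F⇒IndC σ σ∈B (λ F⊆σ → xσ≢0 (x∌F σ F⊆σ)) , ∣σ∣≡k)
      (no  σ∉Bₖ)          → xσ≢0 (xc σ σ∉Bₖ)

  IndC-chain-∌F : ∀ k u → IsChain IndC k u → ∀ σ → F ⊆ᵉ σ → u σ ≡ + 0
  IndC-chain-∌F k u uc σ F⊆σ = uc σ (λ (σ∈A , _) → IndC⇒∌F σ σ∈A F⊆σ)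

  restrict∘extend-chain : ∀ m d → IsChain IndC∶F m d → ∀ τ → restrict (extend d) τ ≡ d τ
  restrict∘extend-chain m d dc τ = case disjoint? τ F of λ where
    (yes dτ) → restrict∘extend d τ dτ
    (no ¬dτ) → trans (restrict-nondisjoint (extend d) τ ¬dτ) (sym (IndC∶F-chain-nondisjoint m d dc τ ¬dτ))

  ∂-extend : ∀ m d → IsChain IndC∶F m d → ∀ σ → F ⊆ᵉ σ →
    ∂ (extend d) σ ≡ ε (σ FS.─ F) * ∂ d (σ FS.─ F)
  ∂-extend m d dc σ F⊆σ = begin
    ∂ (extend d) σ
      ≡⟨ cong (∂ (extend d)) (sym ([σ─F]∪F≡σ σ F⊆σ)) ⟩
    ∂ (extend d) ((σ FS.─ F) FS.∪ F)
      ≡⟨ ∂-at-∪F (extend d) (σ FS.─ F) (disjoint-─ σ) ⟩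
    ε (σ FS.─ F) * ∂ (restrict (extend d)) (σ FS.─ F)
      ≡⟨ cong (ε (σ FS.─ F) *_) (∂-cong _ d (restrict∘extend-chain m d dc) (σ FS.─ F)) ⟩
    ε (σ FS.─ F) * ∂ d (σ FS.─ F)
      ∎
    where open ≡-Reasoning

  restrict-cycle : ∀ z → IsCycle z → IsCycle (restrict z)
  restrict-cycle z zcyc τ with disjoint? τ F
  ... | no ¬d = ∂-restrict-nondisjoint z τ ¬d
  ... | yes d = trans (∂-restrict z τ d) (trans (cong (ε τ *_) (zcyc (τ FS.∪ F))) (ℤP.*-zeroʳ (ε τ)))

  ∂-extend-cycle-∌F : ∀ m y → IsChain IndC∶F m y → IsCycle y → ∀ σ → F ⊆ᵉ σ → ∂ (extend y) σ ≡ + 0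
  ∂-extend-cycle-∌F m y yc ycyc σ F⊆σ =
    trans (∂-extend m y yc σ F⊆σ) (trans (cong (ε (σ FS.─ F) *_) (ycyc _)) (ℤP.*-zeroʳ (ε (σ FS.─ F))))

  ∂-restrict-lift : ∀ m y → IsChain IndC∶F m y → ∀ k u → IsChain IndC k u →
    ∀ t → (∀ σ → ∂ t σ ≡ (extend y -ᶜ u) σ) → ∀ τ → ∂ (restrict t) τ ≡ y τ
  ∂-restrict-lift m y yc k u uc t ∂t τ with disjoint? τ F
  ... | no ¬d = trans (∂-restrict-nondisjoint t τ ¬d) (sym (IndC∶F-chain-nondisjoint m y yc τ ¬d))
  ... | yes d = begin
    ∂ (restrict t) τ
      ≡⟨ ∂-restrict t τ d ⟩
    ε τ * ∂ t (τ FS.∪ F)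
      ≡⟨ cong (ε τ *_) (∂t (τ FS.∪ F)) ⟩
    ε τ * (extend y (τ FS.∪ F) - u (τ FS.∪ F))
      ≡⟨ cong₂ (λ p q → ε τ * (p - q)) (extend-at-∪F y τ d)
        (IndC-chain-∌F k u uc (τ FS.∪ F) (q⊆ᵉp∪q τ F)) ⟩
    ε τ * (ε τ * y τ - + 0)
      ≡⟨ cong (ε τ *_) (ℤP.+-identityʳ (ε τ * y τ)) ⟩
    ε τ * (ε τ * y τ)
      ≡⟨ ε-cancelˡ τ (y τ) ⟩
    y τ
      ∎
    where open ≡-Reasoning

  -- For a cycle y of Ind(C : F), ∂ (extend y) avoids F, so it is a boundary ∂ u in Ind(C);
  -- then extend y − u is a cycle of Ind(C − F), a boundary ∂ t, and restrict t fills y.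
  IndC∶F-HVanish : ∀ j k → suc k ≡ j ℕ.+ f → HVanish IndC k → HVanish IndC∖F (suc k) → HVanish IndC∶F j
  IndC∶F-HVanish j k 1+k≡j+f hA hB y yc ycyc
    with hA (∂ (extend y)) ∂Ly-IsChain (∂∘∂≡0 (extend y))
    where
    ∂Ly-IsChain : IsChain IndC k (∂ (extend y))
    ∂Ly-IsChain = IndC∖F-chain⇒IndC-chain k _
      (IsChain-∂ IndC∖F (Ind-downClosed _ _) k _ (extend-IsChain y 1+k≡j+f yc))
      (∂-extend-cycle-∌F j y yc ycyc)
  ... | u , uc , ∂u with hB (extend y -ᶜ u) Ly-u-IsChain Ly-u-cycle
    where
    Ly-u-IsChain : IsChain IndC∖F (suc k) (extend y -ᶜ u)
    Ly-u-IsChain = IsChain--ᶜ IndC∖F (suc k) (extend-IsChain y 1+k≡j+f yc)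
      (IsChain-mono IndC⊆IndC∖F (suc k) uc)
    Ly-u-cycle : IsCycle (extend y -ᶜ u)
    Ly-u-cycle τ = trans (∂-- (extend y) u τ)
      (trans (cong (λ q → ∂ (extend y) τ - q) (∂u τ)) (ℤP.+-inverseʳ (∂ (extend y) τ)))
  ... | t , tc , ∂t = restrict t ,
    restrict-IsChain t (cong suc 1+k≡j+f) tc ,
    ∂-restrict-lift j y yc (suc k) u uc t ∂t

  ∂-extend-filling : ∀ j d → IsChain IndC∶F (suc j) d → ∀ z → (∀ τ → ∂ d τ ≡ restrict z τ) →
    ∀ σ → F ⊆ᵉ σ → ∂ (extend d) σ ≡ z σ
  ∂-extend-filling j d dc z ∂d σ F⊆σ = begin
    ∂ (extend d) σ
      ≡⟨ ∂-extend (suc j) d dc σ F⊆σ ⟩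
    ε (σ FS.─ F) * ∂ d (σ FS.─ F)
      ≡⟨ cong (ε (σ FS.─ F) *_) (∂d (σ FS.─ F)) ⟩
    ε (σ FS.─ F) * restrict z (σ FS.─ F)
      ≡⟨ cong (ε (σ FS.─ F) *_) (restrict-disjoint z _ (disjoint-─ σ)) ⟩
    ε (σ FS.─ F) * (ε (σ FS.─ F) * z ((σ FS.─ F) FS.∪ F)) ≡⟨ ε-cancelˡ (σ FS.─ F) _ ⟩
    z ((σ FS.─ F) FS.∪ F)
      ≡⟨ cong z ([σ─F]∪F≡σ σ F⊆σ) ⟩
    z σ
      ∎
    where open ≡-Reasoning

  -- No face of cardinality k < |F| contains F, so a k-cycle of Ind(C − F) lives on Ind(C).
  IndC∖F-HVanish-small : ∀ k → k ℕ.< f → HVanish IndC k → HVanish IndC∖F k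
  IndC∖F-HVanish-small k k<f hA z zc zcyc with hA z zA zcyc
    where
    zA : IsChain IndC k z
    zA = IndC∖F-chain⇒IndC-chain k z zc λ σ F⊆σ →
      zc σ (λ (_ , ∣σ∣≡k) → ℕP.<⇒≱ k<f (subst (f ℕ.≤_) ∣σ∣≡k (∣p∣≤∣q∣ {p = F} {σ} F⊆σ)))
  ... | e , ec , ∂e = e , IsChain-mono IndC⊆IndC∖F (suc k) ec , ∂e

  -- Fill restrict z in Ind(C : F) by d; then z − ∂ (extend d) avoids F, so it is a cycle
  -- of Ind(C), filled there by e, and e + extend d fills z.
  IndC∖F-HVanish-large : ∀ j k → k ≡ j ℕ.+ f → HVanish IndC k → HVanish IndC∶F j → HVanish IndC∖F k
  IndC∖F-HVanish-large j k k≡j+f hA hK z zc zcyc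
    with hK (restrict z) (restrict-IsChain z k≡j+f zc) (restrict-cycle z zcyc)
  ... | d , dc , ∂d with hA (z -ᶜ ∂ (extend d)) z-∂Ld-IsChain z-∂Ld-cycle
    where
    z-∂Ld-IsChain : IsChain IndC k (z -ᶜ ∂ (extend d))
    z-∂Ld-IsChain = IndC∖F-chain⇒IndC-chain k _
      (IsChain--ᶜ IndC∖F k zc
        (IsChain-∂ IndC∖F (Ind-downClosed _ _) k _ (extend-IsChain d (cong suc k≡j+f) dc)))
      (λ σ F⊆σ → trans (cong (λ q → z σ - q) (∂-extend-filling j d dc z ∂d σ F⊆σ))
                       (ℤP.+-inverseʳ (z σ)))
    z-∂Ld-cycle : IsCycle (z -ᶜ ∂ (extend d))
    z-∂Ld-cycle τ = trans (∂-- z (∂ (extend d)) τ)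
      (cong₂ _-_ (zcyc τ) (∂∘∂≡0 (extend d) τ))
  ... | e , ec , ∂e = e +ᶜ extend d ,
    IsChain-+ᶜ IndC∖F (suc k) (IsChain-mono IndC⊆IndC∖F (suc k) ec)
      (extend-IsChain d (cong suc k≡j+f) dc) ,
    λ σ → trans (∂-+ e (extend d) σ)
                (trans (cong (_+ ∂ (extend d) σ) (∂e σ)) (cancel (z σ) (∂ (extend d) σ)))
    where
    cancel : ∀ a b → (a - b) + b ≡ a
    cancel = solve-∀

  IndC∖F-HVanish : ∀ k → HVanish IndC k → (∀ j → k ≡ j ℕ.+ f → HVanish IndC∶F j) → HVanish IndC∖F k
  IndC∖F-HVanish k hA hK with f ℕP.≤? k
  ... | no  f≰k = IndC∖F-HVanish-small k (ℕP.≰⇒> f≰k) hA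
  ... | yes f≤k = IndC∖F-HVanish-large (k ℕ.∸ f) k k≡j+f hA (hK (k ℕ.∸ f) k≡j+f)
    where
    k≡j+f : k ≡ k ℕ.∸ f ℕ.+ f
    k≡j+f = sym (ℕP.m∸n+n≡m f≤k)

Acyclic∞ : ∀ {n} → (Subset n → Set) → ℤ∞ → Set
Acyclic∞ Δ (fin m) = Acyclic Δ m
Acyclic∞ Δ ∞       = ∀ m → Acyclic Δ m

suc∞ : ℤ∞ → ℤ∞
suc∞ (fin m) = fin (m + + 1)
suc∞ ∞       = ∞

≤∞-refl : ∀ a → a ≤∞ a
≤∞-refl (fin m) = fin≤fin ℤP.≤-refl
≤∞-refl ∞       = ∞ ≤∞∞

<∞⇒suc∞≤∞ : ∀ {a b} → a <∞ b → suc∞ a ≤∞ b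
<∞⇒suc∞≤∞ {fin m} {fin m′} m<m′ = fin≤fin (subst (ℤ._≤ m′) (ℤP.+-comm (+ 1) m) (ℤP.i<j⇒suc[i]≤j m<m′))
<∞⇒suc∞≤∞ {fin m} {∞}      _    = _ ≤∞∞

Acyclic-mono : ∀ {n} (Δ : Subset n → Set) {x y} → x ℤ.≤ y → Acyclic Δ y → Acyclic Δ x
Acyclic-mono Δ x≤y acy k k≤x+1 = acy k (ℤP.≤-trans k≤x+1 (ℤP.+-monoˡ-≤ (+ 1) x≤y))

≤ConnH⇒Acyclic∞ : ∀ {n} {Δ : Subset n → Set} {a x} → ConnH Δ a → x ≤∞ a → Acyclic∞ Δ x
≤ConnH⇒Acyclic∞ {a = fin m} (acy , _) (fin≤fin x≤m) = Acyclic-mono _ x≤m acy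
≤ConnH⇒Acyclic∞ {a = ∞} {fin x} acy _ = acy x
≤ConnH⇒Acyclic∞ {a = ∞} {∞}     acy _ = acy

Acyclic∞⇒≤ConnH : ∀ {n} {Δ : Subset n → Set} {a x} → ConnH Δ a → Acyclic∞ Δ x → x ≤∞ a
Acyclic∞⇒≤ConnH {a = ∞}                 _          _   = _ ≤∞∞
Acyclic∞⇒≤ConnH {a = fin m} {x = ∞}     (_ , ¬acy) acy = ⊥-elim (¬acy (acy (m + + 1)))
Acyclic∞⇒≤ConnH {a = fin m} {x = fin x} (_ , ¬acy) acy with x ℤP.≤? m
... | yes x≤m = fin≤fin x≤m
... | no  x≰m = ⊥-elim (¬acy (Acyclic-mono _ m+1≤x acy))
  where
  m+1≤x : m + + 1 ℤ.≤ x
  m+1≤x = subst (ℤ._≤ x) (ℤP.+-comm (+ 1) m) (ℤP.i<j⇒suc[i]≤j (ℤP.≰⇒> x≰m))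

-- A face τ of Ind(C : F) sits in degree |τ| − 1, its image τ ∪ F in degree |τ| + |F| − 1.
degree-shift⇒ : ∀ m f j → + j ℤ.≤ (m - + f + + 1) + + 1 → + (j ℕ.+ f) ℤ.≤ (m + + 1) + + 1
degree-shift⇒ m f j j≤ = begin
  + (j ℕ.+ f)                   ≡⟨ ℤP.pos-+ j f ⟩
  + j + + f                     ≤⟨ ℤP.+-monoˡ-≤ (+ f) j≤ ⟩
  ((m - + f + + 1) + + 1) + + f ≡⟨ rearrange m (+ f) ⟩
  (m + + 1) + + 1               ∎
  where
  open ℤP.≤-Reasoning
  rearrange : ∀ m g → ((m - g + + 1) + + 1) + g ≡ (m + + 1) + + 1
  rearrange = solve-∀

degree-shift⇐ : ∀ m f j → + (j ℕ.+ f) ℤ.≤ (m + + 1) + + 1 → + j ℤ.≤ (m - + f + + 1) + + 1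
degree-shift⇐ m f j j+f≤ = begin
  + j                           ≡⟨ rearrange₁ (+ j) (+ f) ⟩
  (+ j + + f) - + f             ≡⟨ cong (_- + f) (sym (ℤP.pos-+ j f)) ⟩
  + (j ℕ.+ f) - + f             ≤⟨ ℤP.+-monoˡ-≤ (- + f) j+f≤ ⟩
  ((m + + 1) + + 1) - + f       ≡⟨ rearrange₂ m (+ f) ⟩
  (m - + f + + 1) + + 1         ∎
  where
  open ℤP.≤-Reasoning
  rearrange₁ : ∀ a g → a ≡ (a + g) - g
  rearrange₁ = solve-∀
  rearrange₂ : ∀ m g → ((m + + 1) + + 1) - g ≡ (m - g + + 1) + + 1
  rearrange₂ = solve-∀

+[1+k]≤x+1⇒+k≤x : ∀ k x → + suc k ℤ.≤ x + + 1 → + k ℤ.≤ x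
+[1+k]≤x+1⇒+k≤x k x 1+k≤ = begin
  + k                 ≡⟨ rearrange₁ (+ k) ⟩
  (+ 1 + + k) - + 1   ≤⟨ ℤP.+-monoˡ-≤ (- + 1) 1+k≤ ⟩
  (x + + 1) - + 1     ≡⟨ rearrange₂ x ⟩
  x                   ∎
  where
  open ℤP.≤-Reasoning
  rearrange₁ : ∀ a → a ≡ (+ 1 + a) - + 1
  rearrange₁ = solve-∀
  rearrange₂ : ∀ a → (a + + 1) - + 1 ≡ a
  rearrange₂ = solve-∀

module Transfer {n} (C : Hypergraph n) (F : Subset n) (F∈C : Edge C F) where
  open Complexes C F F∈C
  open Chase C F F∈C

  f≡1+[f∸1] : f ≡ suc (f ℕ.∸ 1)
  f≡1+[f∸1] = sym (ℕP.m+[n∸m]≡n (ℕP.≤-trans (ℕP.n≤1+n 1) (edge-size C F F∈C)))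

  IndC∶F-Acyclic : ∀ m → Acyclic IndC m → Acyclic IndC∖F (m + + 1) → Acyclic IndC∶F (m - + f + + 1)
  IndC∶F-Acyclic m acA acB j j≤ =
    IndC∶F-HVanish j k 1+k≡j+f (acA k (+[1+k]≤x+1⇒+k≤x k (m + + 1) 1+k≤)) (acB (suc k) 1+k≤)
    where
    k : ℕ
    k = j ℕ.+ (f ℕ.∸ 1)
    1+k≡j+f : suc k ≡ j ℕ.+ f
    1+k≡j+f = trans (sym (ℕP.+-suc j (f ℕ.∸ 1))) (cong (j ℕ.+_) (sym f≡1+[f∸1]))
    1+k≤ : + suc k ℤ.≤ (m + + 1) + + 1
    1+k≤ = subst (λ i → + i ℤ.≤ (m + + 1) + + 1) (sym 1+k≡j+f) (degree-shift⇒ m f j j≤)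

  IndC∖F-Acyclic : ∀ m → Acyclic IndC m → Acyclic IndC∶F (m - + f + + 1) → Acyclic IndC∖F m
  IndC∖F-Acyclic m acA acK k k≤ = IndC∖F-HVanish k (acA k k≤) λ j k≡j+f →
    acK j (degree-shift⇐ m f j (subst (λ i → + i ℤ.≤ (m + + 1) + + 1) k≡j+f
      (ℤP.≤-trans k≤ (ℤP.i≤i+j (m + + 1) (+ 1)))))

  IndC∶F-Acyclic∞ : ∀ a → Acyclic∞ IndC a → Acyclic∞ IndC∖F (suc∞ a) → Acyclic∞ IndC∶F (a ⊖ f ⊕1)
  IndC∶F-Acyclic∞ (fin m) = IndC∶F-Acyclic m
  IndC∶F-Acyclic∞ ∞ acA acB m = Acyclic-mono IndC∶F (ℤP.≤-reflexive (rearrange m (+ f)))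
    (IndC∶F-Acyclic m′ (acA m′) (acB (m′ + + 1)))
    where
    m′ : ℤ
    m′ = m + + f - + 1
    rearrange : ∀ m g → m ≡ (m + g - + 1) - g + + 1
    rearrange = solve-∀

  IndC∖F-Acyclic∞ : ∀ a → Acyclic∞ IndC a → Acyclic∞ IndC∶F (a ⊖ f ⊕1) → Acyclic∞ IndC∖F a
  IndC∖F-Acyclic∞ (fin m) = IndC∖F-Acyclic m
  IndC∖F-Acyclic∞ ∞ acA acK m = IndC∖F-Acyclic m (acA m) (acK (m - + f + + 1))

lemma3p14 : ∀ {n} (C : Hypergraph n) (F : Subset n) → Edge C F →
    ∀ (a b c : ℤ∞) →
    ConnH (Ind allV (Edge C)) a →
    ConnH (Ind allV (minusEdges C F)) b →
    ConnH (Ind (colonVerts C F) (colonEdges C F)) c →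
    (a <∞ b → (a ⊖ ∣ F ∣ ⊕1) ≤∞ c) × ((a ⊖ ∣ F ∣ ⊕1) ≤∞ c → a ≤∞ b)
lemma3p14 C F F∈C a b c conn-a conn-b conn-c =
  (λ a<b → Acyclic∞⇒≤ConnH conn-c
             (IndC∶F-Acyclic∞ a acyclic-a (≤ConnH⇒Acyclic∞ conn-b (<∞⇒suc∞≤∞ a<b)))) ,
  (λ a-f+1≤c → Acyclic∞⇒≤ConnH conn-b
                 (IndC∖F-Acyclic∞ a acyclic-a (≤ConnH⇒Acyclic∞ conn-c a-f+1≤c)))
  where
  open Transfer C F F∈C
  acyclic-a : Acyclic∞ (Ind allV (Edge C)) a
  acyclic-a = ≤ConnH⇒Acyclic∞ conn-a (≤∞-refl a)
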